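{- Every connected graph $G$ is strong-topfull, i.e., if $G$ has $n$ vertices then $\mathrm{cap}^\boxtimes_1(G)=n$.
   Context: Graphs are finite, simple and undirected; $d_G$ denotes shortest-path distance. For an integer $\ell\ge 0$, a weak walk of length $\ell$ on $G$ is a function $f:\{0,\dots,\ell\}\to V(G)$ with $f(i)=f(i+1)$ or $f(i)f(i+1)\in E(G)$ for all $0\le i<\ell$; a weak $\ell$-track is a surjective weak walk. For $f,g:\{0,\dots,\ell\}\to V(G)$, $m_G(f,g)=\min_i d_G(f(i),g(i))$; for a family $F=\{f_1,\dots,f_p\}$ with $p\ge2$, $m_G(F)=\min_{i\ne j}m_G(f_i,f_j)$, and $m_G(F)=\infty$ if $p=1$. A weak $\ell$-tour is a family of weak $\ell$-tracks. The strong $1$-capacity $\mathrm{cap}^\boxtimes_1(G)$ (defined for non-trivial connected $G$) is the maximum $c$ such that there is a weak $\ell$-tour $F=\{f_1,\dots,f_c\}$ on $G$ (for some $\ell$) with $m_G(F)=1$. A connected graph on $n$ vertices is called strong-topfull if $\mathrm{cap}^\boxtimes_1(G)=n$. -}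

module Defs where

open import Level using (0ℓ)
open import Data.Nat using (ℕ; zero; suc; _≤_; _<_)
open import Data.Fin using (Fin; inject₁) renaming (suc to fsuc)
open import Data.Product using (Σ; ∃; _×_; _,_)
open import Data.Sum using (_⊎_)
open import Relation.Binary.PropositionalEquality using (_≡_)
open import Relation.Nullary using (¬_)

record Graph (n : ℕ) : Set₁ where
  field
    Adj   : Fin n → Fin n → Set
    sym   : ∀ {u v} → Adj u v → Adj v u
    irrefl : ∀ {u} → ¬ Adj u u
open Graph public

data Walk {n : ℕ} (G : Graph n) : Fin n → Fin n → ℕ → Set where
  here  : ∀ {u} → Walk G u u zero
  step  : ∀ {u w v k} → Adj G u w → Walk G w v k → Walk G u v (suc k)

Connected : ∀ {n} → Graph n → Set
Connected G = ∀ u v → ∃ λ k → Walk G u v k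

Dist : ∀ {n} → Graph n → Fin n → Fin n → ℕ → Set
Dist G u v k = Walk G u v k × (∀ j → j < k → ¬ Walk G u v j)

WeakWalk : ∀ {n} → Graph n → (ℓ : ℕ) → (Fin (suc ℓ) → Fin n) → Set
WeakWalk G ℓ f = ∀ (i : Fin ℓ) → f (inject₁ i) ≡ f (fsuc i) ⊎ Adj G (f (inject₁ i)) (f (fsuc i))

WeakTrack : ∀ {n} → Graph n → (ℓ : ℕ) → (Fin (suc ℓ) → Fin n) → Set
WeakTrack G ℓ f = WeakWalk G ℓ f × (∀ v → ∃ λ i → f i ≡ v)

-- m_G(F) = 1 for a family F = {f_1,…,f_c} (c ≥ 2; for c = 1, m_G(F) = ∞ ≠ 1):
-- the minimum over pairs i ≠ j and times t of d_G(f_i t, f_j t) equals 1.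
MinSep1 : ∀ {n} → Graph n → (ℓ c : ℕ) → (Fin c → Fin (suc ℓ) → Fin n) → Set
MinSep1 G ℓ c F =
  (2 ≤ c)
  × (∀ i j → ¬ i ≡ j → ∀ t k → Dist G (F i t) (F j t) k → 1 ≤ k)
  × (Σ (Fin c) λ i → Σ (Fin c) λ j → ¬ i ≡ j × Σ (Fin (suc ℓ)) λ t → Dist G (F i t) (F j t) 1)

HasTour1 : ∀ {n} → Graph n → ℕ → Set
HasTour1 {n} G c = Σ ℕ λ ℓ → Σ (Fin c → Fin (suc ℓ) → Fin n) λ F →
  (∀ i j → F i ≡ F j → i ≡ j) × (∀ i → WeakTrack G ℓ (F i)) × MinSep1 G ℓ c F

StrongCap1≡ : ∀ {n} → Graph n → ℕ → Set
StrongCap1≡ G c = HasTour1 G c × (∀ c' → HasTour1 G c' → c' ≤ c)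

StrongTopfull : ∀ {n} → Graph n → Set
StrongTopfull {n} G = StrongCap1≡ G n

-- Put one token on every vertex and move the tokens only by swapping the two
-- tokens at the ends of an edge.  Each token then stays put or crosses one edge
-- per step, and the tokens always sit on pairwise distinct vertices, so their
-- trajectories form a weak tour whose tracks stay at distance at least 1.  To
-- bring the token of i to u, swap along a walk from i to u and then undo these
-- swaps in reverse order; this excursion restores the initial configuration, so
-- the excursions for all pairs (i , u) can be concatenated and every track
-- becomes surjective.  At time 0 two adjacent tokens are at distance exactly 1.
-- Conversely, the tracks of any tour with m = 1 occupy distinct vertices at
-- time 0, so there are at most n of them.
module Submission where

open import Defs
open import Data.Nat using (ℕ; zero; suc; _≤_; _<_; z≤n; s≤s)
open import Data.Nat.Properties using (m≤m+n; ≤-reflexive; ≤-trans)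
open import Data.Fin using (Fin; toℕ; fromℕ<; _≟_) renaming (zero to fzero; suc to fsuc)
open import Data.Fin.Properties using (toℕ-inject₁; toℕ-fromℕ<; injective⇒≤)
open import Data.Fin.Permutation.Components using (transpose; transpose-inverse)
open import Data.List using (List; []; _∷_; _++_; _∷ʳ_; [_]; map; reverse; take; length; lookup; concatMap; allFin; cartesianProduct)
open import Data.List.Properties using (++-assoc; unfold-reverse; take-suc; length-++)
open import Data.List.Membership.Propositional using (_∈_)
open import Data.List.Membership.Propositional.Properties using (∈-allFin; ∈-cartesianProduct⁺)
open import Data.List.Relation.Unary.Any using (here; there)
open import Data.Product using (Σ; ∃; ∃₂; _×_; _,_; proj₂; uncurry)
open import Data.Sum using (_⊎_; inj₁; inj₂)
open import Data.Empty using (⊥-elim)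
open import Function using (_∘_)
open import Relation.Nullary using (¬_; Dec; yes; no)
open import Relation.Nullary.Decidable using (dec-true; dec-false)
open import Relation.Binary.PropositionalEquality using (_≡_; refl; trans; cong; subst; _≢_; module ≡-Reasoning)
  renaming (sym to ≡-sym)

transpose-matchˡ : ∀ {n} (i j : Fin n) → transpose i j i ≡ j
transpose-matchˡ i j rewrite dec-true (i ≟ i) refl = refl

transpose-matchʳ : ∀ {n} (i j : Fin n) → transpose i j j ≡ i
transpose-matchʳ i j = match (j ≟ i)
  where
  match : Dec (j ≡ i) → transpose i j j ≡ i
  match (yes refl) = transpose-matchˡ j j
  match (no j≢i) rewrite dec-false (j ≟ i) j≢i | dec-true (j ≟ j) refl = refl

transpose-mismatch : ∀ {n} {i j k : Fin n} → k ≢ i → k ≢ j → transpose i j k ≡ k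
transpose-mismatch {i = i} {j} {k} k≢i k≢j
  rewrite dec-false (k ≟ i) k≢i | dec-false (k ≟ j) k≢j = refl

take-length-++ : ∀ {A : Set} (xs ys : List A) → take (length xs) (xs ++ ys) ≡ xs
take-length-++ []       ys = refl
take-length-++ (x ∷ xs) ys = cong (x ∷_) (take-length-++ xs ys)

module _ {n : ℕ} (G : Graph n) where

  walk-zero⇒≡ : ∀ {u v} → Walk G u v 0 → u ≡ v
  walk-zero⇒≡ here = refl

  adjacent⇒dist-one : ∀ {u v} → Adj G u v → Dist G u v 1
  adjacent⇒dist-one {u} adj = step adj here , no-shorter
    where
    no-shorter : ∀ j → j < 1 → ¬ Walk G u _ j
    no-shorter zero    _            w = irrefl G (subst (Adj G u) (≡-sym (walk-zero⇒≡ w)) adj)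
    no-shorter (suc _) (s≤s ())

  connected⇒edge : 2 ≤ n → Connected G → ∃₂ (Adj G)
  connected⇒edge (s≤s (s≤s _)) conn with conn fzero (fsuc fzero)
  ... | _ , step adj _ = _ , _ , adj

  distinct⇒separated : ∀ {c ℓ} (F : Fin c → Fin (suc ℓ) → Fin n) →
    (∀ t {i j} → F i t ≡ F j t → i ≡ j) →
    ∀ i j → i ≢ j → ∀ t k → Dist G (F i t) (F j t) k → 1 ≤ k
  distinct⇒separated F inj i j i≢j t zero    (w , _) = ⊥-elim (i≢j (inj t (walk-zero⇒≡ w)))
  distinct⇒separated F inj i j i≢j t (suc k) _       = s≤s z≤n

  tour-size≤ : ∀ {c} → HasTour1 G c → c ≤ n
  tour-size≤ (ℓ , F , _ , _ , _ , separated , _) = injective⇒≤ start-injective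
    where
    start-injective : ∀ {i j} → F i fzero ≡ F j fzero → i ≡ j
    start-injective {i} {j} eq with i ≟ j
    ... | yes i≡j = i≡j
    ... | no i≢j with separated i j i≢j fzero 0 (subst (λ v → Walk G (F i fzero) v 0) eq here , λ _ ())
    ... | ()

  Edge : Set
  Edge = Σ (Fin n × Fin n) (uncurry (Adj G))

  flipEdge : Edge → Edge
  flipEdge ((a , b) , adj) = (b , a) , Graph.sym G adj

  swapAlong : Edge → Fin n → Fin n
  swapAlong ((a , b) , _) = transpose a b

  swapAlong-weak : ∀ e x → x ≡ swapAlong e x ⊎ Adj G x (swapAlong e x)
  swapAlong-weak ((a , b) , adj) x = cases (x ≟ a) (x ≟ b)
    where
    cases : Dec (x ≡ a) → Dec (x ≡ b) → x ≡ transpose a b x ⊎ Adj G x (transpose a b x)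
    cases (yes refl) _          = inj₂ (subst (Adj G x) (≡-sym (transpose-matchˡ x b)) adj)
    cases (no _)     (yes refl) = inj₂ (subst (Adj G x) (≡-sym (transpose-matchʳ a x)) (Graph.sym G adj))
    cases (no x≢a)   (no x≢b)   = inj₁ (≡-sym (transpose-mismatch x≢a x≢b))

  applySwaps : List Edge → Fin n → Fin n
  applySwaps []      x = x
  applySwaps (e ∷ L) x = applySwaps L (swapAlong e x)

  applySwaps-++ : ∀ L M x → applySwaps (L ++ M) x ≡ applySwaps M (applySwaps L x)
  applySwaps-++ []      M x = refl
  applySwaps-++ (e ∷ L) M x = applySwaps-++ L M (swapAlong e x)

  -- The edges are flipped so that transpose-inverse cancels each swap.
  undo : List Edge → List Edge
  undo = reverse ∘ map flipEdge

  applySwaps-undo : ∀ L x → applySwaps (undo L) (applySwaps L x) ≡ x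
  applySwaps-undo []              x = refl
  applySwaps-undo (e@((a , b) , _) ∷ L) x = begin
    applySwaps (undo (e ∷ L)) (applySwaps L (transpose a b x))
      ≡⟨ cong (λ M → applySwaps M (applySwaps L (transpose a b x))) (unfold-reverse (flipEdge e) (map flipEdge L)) ⟩
    applySwaps (undo L ∷ʳ flipEdge e) (applySwaps L (transpose a b x))
      ≡⟨ applySwaps-++ (undo L) [ flipEdge e ] _ ⟩
    transpose b a (applySwaps (undo L) (applySwaps L (transpose a b x)))
      ≡⟨ cong (transpose b a) (applySwaps-undo L (transpose a b x)) ⟩
    transpose b a (transpose a b x)
      ≡⟨ transpose-inverse b a ⟩
    x ∎
    where open ≡-Reasoning

  applySwaps-injective : ∀ L {x y} → applySwaps L x ≡ applySwaps L y → x ≡ y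
  applySwaps-injective L {x} {y} eq =
    trans (≡-sym (applySwaps-undo L x)) (trans (cong (applySwaps (undo L)) eq) (applySwaps-undo L y))

  walkEdges : ∀ {u v k} → Walk G u v k → List Edge
  walkEdges here                   = []
  walkEdges (step {u} {w} adj rest) = ((u , w) , adj) ∷ walkEdges rest

  applySwaps-walkEdges : ∀ {u v k} (w : Walk G u v k) → applySwaps (walkEdges w) u ≡ v
  applySwaps-walkEdges here                    = refl
  applySwaps-walkEdges (step {u} {w} adj rest) rewrite transpose-matchˡ u w = applySwaps-walkEdges rest

  Restoring : List Edge → Set
  Restoring L = ∀ x → applySwaps L x ≡ x

  Visits : List Edge → Fin n → Fin n → Set
  Visits L x u = ∃₂ λ P Q → L ≡ P ++ Q × applySwaps P x ≡ u

  visits-++ˡ : ∀ {L x u} M → Visits L x u → Visits (L ++ M) x u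
  visits-++ˡ M (P , Q , refl , moves) = P , Q ++ M , ++-assoc P Q M , moves

  visits-++ʳ : ∀ {M x u} L → Restoring L → Visits M x u → Visits (L ++ M) x u
  visits-++ʳ {x = x} L restoring (P , Q , refl , moves) =
    L ++ P , Q , ≡-sym (++-assoc L P Q) ,
    trans (applySwaps-++ L P x) (trans (cong (applySwaps P) (restoring x)) moves)

  visits-concatMap : ∀ {A : Set} (f : A → List Edge) → (∀ a → Restoring (f a)) →
    ∀ {as a x u} → a ∈ as → Visits (f a) x u → Visits (concatMap f as) x u
  visits-concatMap f restoring {b ∷ as} (here refl) visits = visits-++ˡ (concatMap f as) visits
  visits-concatMap f restoring {b ∷ as} (there a∈as) visits =
    visits-++ʳ (f b) (restoring b) (visits-concatMap f restoring a∈as visits)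

  excursion : ∀ {u v k} → Walk G u v k → List Edge
  excursion w = walkEdges w ++ undo (walkEdges w)

  excursion-restoring : ∀ {u v k} (w : Walk G u v k) → Restoring (excursion w)
  excursion-restoring w x = trans (applySwaps-++ (walkEdges w) _ x) (applySwaps-undo (walkEdges w) x)

  excursion-visits : ∀ {u v k} (w : Walk G u v k) → Visits (excursion w) u v
  excursion-visits w = walkEdges w , undo (walkEdges w) , refl , applySwaps-walkEdges w

  trajectories : (L : List Edge) → Fin n → Fin (suc (length L)) → Fin n
  trajectories L x t = applySwaps (take (toℕ t) L) x

  trajectory-weakWalk : ∀ L x → WeakWalk G (length L) (trajectories L x)
  trajectory-weakWalk L x t rewrite toℕ-inject₁ t | take-suc L t
    | applySwaps-++ (take (toℕ t) L) [ lookup L t ] x =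
    swapAlong-weak (lookup L t) (applySwaps (take (toℕ t) L) x)

  trajectory-reaches : ∀ L {x u} → Visits L x u → ∃ λ t → trajectories L x t ≡ u
  trajectory-reaches L {x} (P , Q , refl , moves) = fromℕ< |P|<|L|+1 , (begin
    applySwaps (take (toℕ (fromℕ< |P|<|L|+1)) (P ++ Q)) x ≡⟨ cong (λ m → applySwaps (take m (P ++ Q)) x) (toℕ-fromℕ< |P|<|L|+1) ⟩
    applySwaps (take (length P) (P ++ Q)) x             ≡⟨ cong (λ M → applySwaps M x) (take-length-++ P Q) ⟩
    applySwaps P x                                      ≡⟨ moves ⟩
    _ ∎)
    where
    open ≡-Reasoning
    |P|<|L|+1 : length P < suc (length (P ++ Q))
    |P|<|L|+1 = s≤s (≤-trans (m≤m+n (length P) (length Q)) (≤-reflexive (≡-sym (length-++ P))))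

  module _ (conn : Connected G) where

    schedule : List Edge
    schedule = concatMap (λ (i , u) → excursion (proj₂ (conn i u))) (cartesianProduct (allFin n) (allFin n))

    schedule-visits : ∀ i u → Visits schedule i u
    schedule-visits i u =
      visits-concatMap _ (λ (j , v) → excursion-restoring (proj₂ (conn j v)))
        (∈-cartesianProduct⁺ (∈-allFin i) (∈-allFin u)) (excursion-visits (proj₂ (conn i u)))

    schedule-track : ∀ i → WeakTrack G (length schedule) (trajectories schedule i)
    schedule-track i = trajectory-weakWalk schedule i , λ u → trajectory-reaches schedule (schedule-visits i u)

proposition3p16 : ∀ (n : ℕ) (G : Graph n) → 2 ≤ n → Connected G → StrongTopfull G
proposition3p16 n G 2≤n conn = tour , λ _ → tour-size≤ G
  where
  F : Fin n → Fin (suc (length (schedule G conn))) → Fin n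
  F = trajectories G (schedule G conn)

  tokens-distinct : ∀ t {i j} → F i t ≡ F j t → i ≡ j
  tokens-distinct t = applySwaps-injective G (take (toℕ t) (schedule G conn))

  tour : HasTour1 G n
  tour with connected⇒edge G 2≤n conn
  ... | u , v , adj =
    length (schedule G conn) , F ,
    (λ i j F≡ → tokens-distinct fzero (cong (λ f → f fzero) F≡)) ,
    schedule-track G conn ,
    2≤n , distinct⇒separated G F tokens-distinct ,
    (u , v , (λ u≡v → irrefl G (subst (Adj G u) (≡-sym u≡v) adj)) , fzero , adjacent⇒dist-one G adj)
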